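{- Let $d\ge 2$ be an integer and let $S_1,S_2\subseteq[d-1]$ satisfy $|S_2\setminus S_1|>1$. Then the family \[ \bigl\{S\subseteq[d-1]:\ |S\cap S_2|-|S\cap S_1|\in\{ -1,0,1\}\bigr\} \] contains at most $\tfrac78\cdot 2^{d-1}$ sets.
   Context: For a positive integer $n$, $[n]=\{1,\dots,n\}$. -}

module Defs where

open import Data.Nat using (ℕ; zero; suc)
open import Data.Fin.Subset using (Subset; _∩_; ∣_∣)
open import Data.Integer using (ℤ; +_; _-_; -[1+_])
open import Relation.Binary.PropositionalEquality using (_≡_)
open import Data.Sum using (_⊎_)

InFamily : {n : ℕ} → Subset n → Subset n → Subset n → Set
InFamily S₁ S₂ S =
  let δ = (+ ∣ S ∩ S₂ ∣) - (+ ∣ S ∩ S₁ ∣) in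
  (δ ≡ -[1+ 0 ]) ⊎ (δ ≡ + 0) ⊎ (δ ≡ + 1)

{-# OPTIONS --safe #-}
-- The imbalance δ(S) = |S ∩ S₂| − |S ∩ S₁| ignores the coordinates on which S₁ and S₂
-- agree, and each of the N = |S₂ ∖ S₁| + |S₁ ∖ S₂| other coordinates moves it by one.
-- Hence, for S uniform, δ(S) + |S₁ ∖ S₂| is binomially distributed with parameters N
-- and 1/2.  Three consecutive values of Bin(3, 1/2) carry mass at most (1 + 3 + 3)/8,
-- and adding further independent coin flips cannot increase that maximum, so N ≥ 3 gives
-- the bound 7/8.  Since |S₂ ∖ S₁| ≥ 2, the only other case is S₁ ⊆ S₂ with
-- |S₂ ∖ S₁| = 2, where δ ~ Bin(2, 1/2) lies in {−1, 0, 1} with probability 3/4.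
module Submission where

open import Defs
open import Data.Nat using (ℕ; _≤_; _<_; _*_; _^_; _∸_)
open import Data.List using (length)
open import Data.Fin.Subset using (Subset; _─_; ∣_∣)
open import Data.List.Relation.Unary.Unique.Propositional using (Unique)
open import Data.List using (List)
open import Data.List.Membership.Propositional using (_∈_)

open import Data.Bool using (Bool; true; false)
open import Data.Bool.Properties using () renaming (_≟_ to _≟ᵇ_)
open import Data.Empty using (⊥-elim)
open import Data.Fin.Subset using (_∩_)
open import Data.Integer using (ℤ; +_; +[1+_]; -[1+_]; -_; _-_)
  renaming (suc to sucℤ; pred to predℤ)
import Data.Integer.Properties as ℤ
open import Data.List using ([]; _∷_)
open import Data.List.Relation.Unary.All as All using (All; []; _∷_)
open import Data.List.Relation.Unary.AllPairs using ([]; _∷_)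
open import Data.Nat using (zero; suc; _+_; z≤n; s≤s)
open import Data.Nat.Properties
open import Algebra.Properties.CommutativeSemigroup +-commutativeSemigroup
  using (interchange)
import Data.Nat.Tactic.RingSolver as ℕ-Solver
open import Data.Sum using (_⊎_; inj₁; inj₂)
open import Data.Vec using ([]; _∷_)
open import Function using (_∘_)
open import Relation.Binary.PropositionalEquality
open import Relation.Nullary using (yes; no)

private
  variable
    n : ℕ

  *-double : ∀ a b → a * (b + b) ≡ 2 * a * b
  *-double = ℕ-Solver.solve-∀

  scale-both : ∀ c a b {w x} → a * w ≡ b * x → c * a * w ≡ c * b * x
  scale-both c a b {w} {x} a*w≡b*x = begin
    c * a * w   ≡⟨ *-assoc c a w ⟩
    c * (a * w) ≡⟨ cong (c *_) a*w≡b*x ⟩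
    c * (b * x) ≡⟨ *-assoc c b x ⟨
    c * b * x   ∎
    where open ≡-Reasoning

  double-sum : ∀ a b {w x} → a * w ≡ b * x → a * (w + w) ≡ 2 * b * x
  double-sum a b {w} a*w≡b*x = trans (*-double a w) (scale-both 2 a b a*w≡b*x)

∑ : (Subset n → ℕ) → ℕ
∑ {zero}  f = f []
∑ {suc n} f = ∑ (f ∘ (true ∷_)) + ∑ (f ∘ (false ∷_))

∑-cong : {f g : Subset n → ℕ} → (∀ S → f S ≡ g S) → ∑ f ≡ ∑ g
∑-cong {zero}  f≗g = f≗g []
∑-cong {suc n} f≗g = cong₂ _+_ (∑-cong (f≗g ∘ (true ∷_))) (∑-cong (f≗g ∘ (false ∷_)))

∑-distrib-+ : (f g : Subset n → ℕ) → ∑ (λ S → f S + g S) ≡ ∑ f + ∑ g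
∑-distrib-+ {zero}  f g = refl
∑-distrib-+ {suc n} f g =
  trans (cong₂ _+_ (∑-distrib-+ (f ∘ (true ∷_)) (g ∘ (true ∷_)))
                   (∑-distrib-+ (f ∘ (false ∷_)) (g ∘ (false ∷_))))
        (interchange (∑ (f ∘ (true ∷_))) (∑ (g ∘ (true ∷_))) (∑ (f ∘ (false ∷_))) _)

slice : Bool → List (Subset (suc n)) → List (Subset n)
slice b [] = []
slice b ((c ∷ S) ∷ F) with c ≟ᵇ b
... | yes _ = S ∷ slice b F
... | no  _ = slice b F

length-slices : (F : List (Subset (suc n))) →
                length F ≡ length (slice true F) + length (slice false F)
length-slices [] = refl
length-slices ((true  ∷ S) ∷ F) = cong suc (length-slices F)
length-slices ((false ∷ S) ∷ F) = trans (cong suc (length-slices F)) (sym (+-suc _ _))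

All-slice : ∀ {p} {P : Subset (suc n) → Set p} b {F} → All P F → All (P ∘ (b ∷_)) (slice b F)
All-slice b {[]} [] = []
All-slice b {(c ∷ S) ∷ F} (px ∷ pxs) with c ≟ᵇ b
... | yes refl = px ∷ All-slice b pxs
... | no  _    = All-slice b pxs

Unique-slice : ∀ b {F : List (Subset (suc n))} → Unique F → Unique (slice b F)
Unique-slice b {[]} [] = []
Unique-slice b {(c ∷ S) ∷ F} (S∉F ∷ F!) with c ≟ᵇ b
... | yes refl = All.map (λ ne → ne ∘ cong (b ∷_)) (All-slice b S∉F) ∷ Unique-slice b F!
... | no  _    = Unique-slice b F!

length≤∑ : {f : Subset n → ℕ} (F : List (Subset n)) → Unique F →
           All (λ S → 1 ≤ f S) F → length F ≤ ∑ f
length≤∑ {zero} []            _                  _        = z≤n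
length≤∑ {zero} ([] ∷ [])     _                  (1≤f ∷ _) = 1≤f
length≤∑ {zero} ([] ∷ [] ∷ _) (([]≢[] ∷ _) ∷ _) _        = ⊥-elim ([]≢[] refl)
length≤∑ {suc n} {f} F F! 1≤f = begin
  length F                                       ≡⟨ length-slices F ⟩
  length (slice true F) + length (slice false F) ≤⟨ +-mono-≤ (sliced true) (sliced false) ⟩
  ∑ f ∎
  where
  open ≤-Reasoning
  sliced : ∀ b → length (slice b F) ≤ ∑ (f ∘ (b ∷_))
  sliced b = length≤∑ (slice b F) (Unique-slice b F!) (All-slice b 1≤f)

imbalance : Subset n → Subset n → Subset n → ℤ
imbalance S₁ S₂ S = + ∣ S ∩ S₂ ∣ - + ∣ S ∩ S₁ ∣

smooth : (ℤ → ℕ) → ℤ → ℕ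
smooth h j = h j + h (sucℤ j)

-- smooth^ N h j = Σₖ (N choose k) · h (j + k)
smooth^ : ℕ → (ℤ → ℕ) → ℤ → ℕ
smooth^ zero    h = h
smooth^ (suc N) h = smooth^ N (smooth h)

smooth^-pred : ∀ N {g h : ℤ → ℕ} → (∀ j → g j ≡ h (predℤ j)) →
               ∀ j → smooth^ N g j ≡ smooth^ N h (predℤ j)
smooth^-pred zero            g≗h∘pred = g≗h∘pred
smooth^-pred (suc N) {h = h} g≗h∘pred = smooth^-pred N λ j →
  cong₂ _+_ (g≗h∘pred j)
            (trans (g≗h∘pred (sucℤ j)) (cong h (trans (ℤ.pred-suc j) (sym (ℤ.suc-pred j)))))

smooth^-bound : ∀ N {h : ℤ → ℕ} {B} → (∀ j → h j ≤ B) → ∀ j → smooth^ N h j ≤ 2 ^ N * B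
smooth^-bound zero    {B = B} h≤B j = ≤-trans (h≤B j) (≤-reflexive (sym (*-identityˡ B)))
smooth^-bound (suc N) {B = B} h≤B j = ≤-trans
  (smooth^-bound N (λ i → +-mono-≤ (h≤B i) (h≤B (sucℤ i))) j)
  (≤-reflexive (*-double (2 ^ N) B))

∑-imbalance-agree : (S₁ S₂ : Subset n) (h : ℤ → ℕ) →
                    ∑ (h ∘ imbalance (true ∷ S₁) (true ∷ S₂)) ≡
                    ∑ (h ∘ imbalance S₁ S₂) + ∑ (h ∘ imbalance S₁ S₂)
∑-imbalance-agree S₁ S₂ h =
  cong (_+ ∑ (h ∘ imbalance S₁ S₂)) (∑-cong λ S → cong h (cancel-suc ∣ S ∩ S₂ ∣ ∣ S ∩ S₁ ∣))
  where
  cancel-suc : ∀ a b → +[1+ a ] - +[1+ b ] ≡ + a - + b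
  cancel-suc a b = trans (ℤ.[1+m]⊖[1+n]≡m⊖n a b) (sym (ℤ.m-n≡m⊖n a b))

∑-imbalance-gain : (S₁ S₂ : Subset n) (h : ℤ → ℕ) →
                   ∑ (h ∘ imbalance (false ∷ S₁) (true ∷ S₂)) ≡ ∑ (smooth h ∘ imbalance S₁ S₂)
∑-imbalance-gain S₁ S₂ h = begin
  ∑ (λ S → h (+[1+ ∣ S ∩ S₂ ∣ ] - + ∣ S ∩ S₁ ∣)) + ∑ (h ∘ imbalance S₁ S₂)
    ≡⟨ cong (_+ ∑ (h ∘ imbalance S₁ S₂))
            (∑-cong λ S → cong h (ℤ.suc-+ ∣ S ∩ S₂ ∣ (- + ∣ S ∩ S₁ ∣))) ⟩
  ∑ (h ∘ sucℤ ∘ imbalance S₁ S₂) + ∑ (h ∘ imbalance S₁ S₂)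
    ≡⟨ +-comm (∑ (h ∘ sucℤ ∘ imbalance S₁ S₂)) _ ⟩
  ∑ (h ∘ imbalance S₁ S₂) + ∑ (h ∘ sucℤ ∘ imbalance S₁ S₂)
    ≡⟨ ∑-distrib-+ (h ∘ imbalance S₁ S₂) (h ∘ sucℤ ∘ imbalance S₁ S₂) ⟨
  ∑ (smooth h ∘ imbalance S₁ S₂) ∎
  where open ≡-Reasoning

∑-imbalance-loss : (S₁ S₂ : Subset n) (h : ℤ → ℕ) →
                   ∑ (h ∘ imbalance (true ∷ S₁) (false ∷ S₂)) ≡
                   ∑ (smooth (h ∘ predℤ) ∘ imbalance S₁ S₂)
∑-imbalance-loss S₁ S₂ h = begin
  ∑ (λ S → h (+ ∣ S ∩ S₂ ∣ - +[1+ ∣ S ∩ S₁ ∣ ])) + ∑ (h ∘ imbalance S₁ S₂)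
    ≡⟨ cong₂ _+_ (∑-cong λ S → cong h (ℤ.minus-suc (+ ∣ S ∩ S₂ ∣) ∣ S ∩ S₁ ∣))
                 (∑-cong λ S → cong h (sym (ℤ.pred-suc (imbalance S₁ S₂ S)))) ⟩
  ∑ (h ∘ predℤ ∘ imbalance S₁ S₂) + ∑ (h ∘ predℤ ∘ sucℤ ∘ imbalance S₁ S₂)
    ≡⟨ ∑-distrib-+ (h ∘ predℤ ∘ imbalance S₁ S₂) (h ∘ predℤ ∘ sucℤ ∘ imbalance S₁ S₂) ⟨
  ∑ (smooth (h ∘ predℤ) ∘ imbalance S₁ S₂) ∎
  where open ≡-Reasoning

imbalance-distribution : (S₁ S₂ : Subset n) (h : ℤ → ℕ) →
  2 ^ (∣ S₂ ─ S₁ ∣ + ∣ S₁ ─ S₂ ∣) * ∑ (h ∘ imbalance S₁ S₂) ≡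
  2 ^ n * smooth^ (∣ S₂ ─ S₁ ∣ + ∣ S₁ ─ S₂ ∣) h (- + ∣ S₁ ─ S₂ ∣)
imbalance-distribution []           []           h = refl
imbalance-distribution {suc n} (false ∷ S₁) (false ∷ S₂) h =
  double-sum (2 ^ (∣ S₂ ─ S₁ ∣ + ∣ S₁ ─ S₂ ∣)) (2 ^ n) (imbalance-distribution S₁ S₂ h)
imbalance-distribution {suc n} (true ∷ S₁) (true ∷ S₂) h =
  trans (cong (2 ^ (∣ S₂ ─ S₁ ∣ + ∣ S₁ ─ S₂ ∣) *_) (∑-imbalance-agree S₁ S₂ h))
        (double-sum (2 ^ (∣ S₂ ─ S₁ ∣ + ∣ S₁ ─ S₂ ∣)) (2 ^ n) (imbalance-distribution S₁ S₂ h))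
imbalance-distribution {suc n} (false ∷ S₁) (true ∷ S₂) h =
  trans (cong (2 ^ suc (∣ S₂ ─ S₁ ∣ + ∣ S₁ ─ S₂ ∣) *_) (∑-imbalance-gain S₁ S₂ h))
        (scale-both 2 (2 ^ (∣ S₂ ─ S₁ ∣ + ∣ S₁ ─ S₂ ∣)) (2 ^ n)
                    (imbalance-distribution S₁ S₂ (smooth h)))
imbalance-distribution {suc n} (true ∷ S₁) (false ∷ S₂) h = begin
  2 ^ (P + suc Q) * ∑ (h ∘ imbalance (true ∷ S₁) (false ∷ S₂))
    ≡⟨ cong₂ (λ N w → 2 ^ N * w) (+-suc P Q) (∑-imbalance-loss S₁ S₂ h) ⟩
  2 * 2 ^ (P + Q) * ∑ (smooth (h ∘ predℤ) ∘ imbalance S₁ S₂)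
    ≡⟨ scale-both 2 (2 ^ (P + Q)) (2 ^ n) (imbalance-distribution S₁ S₂ (smooth (h ∘ predℤ))) ⟩
  2 ^ suc n * smooth^ (suc (P + Q)) (h ∘ predℤ) (- + Q)
    ≡⟨ cong (2 ^ suc n *_) (smooth^-pred (suc (P + Q)) {h = h} (λ _ → refl) (- + Q)) ⟩
  2 ^ suc n * smooth^ (suc (P + Q)) h (predℤ (- + Q))
    ≡⟨ cong₂ (λ N j → 2 ^ suc n * smooth^ N h j) (sym (+-suc P Q)) (sym (ℤ.neg-suc Q)) ⟩
  2 ^ suc n * smooth^ (P + suc Q) h -[1+ Q ] ∎
  where
  open ≡-Reasoning
  P = ∣ S₂ ─ S₁ ∣
  Q = ∣ S₁ ─ S₂ ∣

𝟙[-1,1] : ℤ → ℕ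
𝟙[-1,1] -[1+ 0 ] = 1
𝟙[-1,1] (+ 0)    = 1
𝟙[-1,1] (+ 1)    = 1
𝟙[-1,1] _        = 0

𝟙[-1,1]-positive : ∀ {j} → (j ≡ -[1+ 0 ]) ⊎ (j ≡ + 0) ⊎ (j ≡ + 1) → 1 ≤ 𝟙[-1,1] j
𝟙[-1,1]-positive (inj₁ refl)        = ≤-refl
𝟙[-1,1]-positive (inj₂ (inj₁ refl)) = ≤-refl
𝟙[-1,1]-positive (inj₂ (inj₂ refl)) = ≤-refl

smooth³-𝟙[-1,1]≤7 : ∀ j → smooth^ 3 𝟙[-1,1] j ≤ 7
smooth³-𝟙[-1,1]≤7 (+ 0)                          = ≤ᵇ⇒≤ _ 7 _
smooth³-𝟙[-1,1]≤7 (+ 1)                          = ≤ᵇ⇒≤ _ 7 _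
smooth³-𝟙[-1,1]≤7 (+ suc (suc _))                = ≤ᵇ⇒≤ _ 7 _
smooth³-𝟙[-1,1]≤7 -[1+ 0 ]                       = ≤ᵇ⇒≤ _ 7 _
smooth³-𝟙[-1,1]≤7 -[1+ 1 ]                       = ≤ᵇ⇒≤ _ 7 _
smooth³-𝟙[-1,1]≤7 -[1+ 2 ]                       = ≤ᵇ⇒≤ _ 7 _
smooth³-𝟙[-1,1]≤7 -[1+ 3 ]                       = ≤ᵇ⇒≤ _ 7 _
smooth³-𝟙[-1,1]≤7 -[1+ suc (suc (suc (suc _))) ] = ≤ᵇ⇒≤ _ 7 _

8*∑≤7*2^n-of-distance≥3 : ∀ M {n W j} →
                          2 ^ (3 + M) * W ≡ 2 ^ n * smooth^ (3 + M) 𝟙[-1,1] j →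
                          8 * W ≤ 7 * 2 ^ n
8*∑≤7*2^n-of-distance≥3 M {n} {W} {j} eq = *-cancelˡ-≤ (2 ^ M) {{m^n≢0 2 M}} (begin
  2 ^ M * (8 * W)                   ≡⟨ pull-8 (2 ^ M) W ⟩
  2 ^ (3 + M) * W                   ≡⟨ eq ⟩
  2 ^ n * smooth^ M (smooth^ 3 𝟙[-1,1]) j
    ≤⟨ *-monoʳ-≤ (2 ^ n) (smooth^-bound M smooth³-𝟙[-1,1]≤7 j) ⟩
  2 ^ n * (2 ^ M * 7)               ≡⟨ swap-7 (2 ^ n) (2 ^ M) ⟩
  2 ^ M * (7 * 2 ^ n)               ∎)
  where
  open ≤-Reasoning
  pull-8 : ∀ a w → a * (8 * w) ≡ 2 * (2 * (2 * a)) * w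
  pull-8 = ℕ-Solver.solve-∀
  swap-7 : ∀ b a → b * (a * 7) ≡ a * (7 * b)
  swap-7 = ℕ-Solver.solve-∀

8*∑≤7*2^n : (S₁ S₂ : Subset n) → 1 < ∣ S₂ ─ S₁ ∣ →
            8 * ∑ (𝟙[-1,1] ∘ imbalance S₁ S₂) ≤ 7 * 2 ^ n
8*∑≤7*2^n {n} S₁ S₂ 1<P
  with ∣ S₂ ─ S₁ ∣ | 1<P | ∣ S₁ ─ S₂ ∣ | imbalance-distribution S₁ S₂ 𝟙[-1,1]
... | 1                 | s≤s () | _     | _
... | suc (suc (suc p)) | _      | q     | eq = 8*∑≤7*2^n-of-distance≥3 (p + q) {n = n} eq
... | 2                 | _      | suc q | eq = 8*∑≤7*2^n-of-distance≥3 q {n = n} eq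
... | 2                 | _      | 0     | eq = begin
  8 * W           ≡⟨ *-assoc 2 4 W ⟩
  2 * (4 * W)     ≡⟨ cong (2 *_) eq ⟩
  2 * (2 ^ n * 3) ≡⟨ cong (2 *_) (*-comm (2 ^ n) 3) ⟩
  2 * (3 * 2 ^ n) ≡⟨ *-assoc 2 3 (2 ^ n) ⟨
  6 * 2 ^ n       ≤⟨ *-monoˡ-≤ (2 ^ n) (≤ᵇ⇒≤ 6 7 _) ⟩
  7 * 2 ^ n       ∎
  where
  open ≤-Reasoning
  W = ∑ (𝟙[-1,1] ∘ imbalance S₁ S₂)

lemma1 : (d : ℕ) → 2 ≤ d → (S₁ S₂ : Subset (d ∸ 1)) → 1 < ∣ S₂ ─ S₁ ∣ →
         (F : List (Subset (d ∸ 1))) → Unique F →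
         (∀ {S} → S ∈ F → InFamily S₁ S₂ S) →
         8 * length F ≤ 7 * 2 ^ (d ∸ 1)
-- 2 ≤ d is implied by 1 < ∣ S₂ ─ S₁ ∣.
lemma1 d _ S₁ S₂ 1<∣S₂─S₁∣ F F! F⊆family = begin
  8 * length F                        ≤⟨ *-monoʳ-≤ 8 (length≤∑ F F! 1≤𝟙[-1,1]) ⟩
  8 * ∑ (𝟙[-1,1] ∘ imbalance S₁ S₂)   ≤⟨ 8*∑≤7*2^n S₁ S₂ 1<∣S₂─S₁∣ ⟩
  7 * 2 ^ (d ∸ 1)                     ∎
  where
  open ≤-Reasoning
  1≤𝟙[-1,1] : All (λ S → 1 ≤ 𝟙[-1,1] (imbalance S₁ S₂ S)) F
  1≤𝟙[-1,1] = All.tabulate (𝟙[-1,1]-positive ∘ F⊆family)
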